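{- Let $P=P_1\cdots P_p$ and $T=T_1\cdots T_t$ be strings over a finite alphabet $\Sigma$. The GSM algorithm (described in the context), run on $P$ and $T$, is correct: for every position $k$, it reports a match on position $k$ if and only if $P$ swap matches $T$ at location $k$.
   Context: For a string $S$ of length $n$, $S_i$ is its $i$-th symbol and $S_{[i,j]}=S_iS_{i+1}\cdots S_j$. A swap permutation for $S$ is a permutation $\pi$ of $\{1,\dots,n\}$ such that (i) $\pi(i)=j$ implies $\pi(j)=i$; (ii) $\pi(i)\in\{i-1,i,i+1\}$ for all $i$; (iii) if $\pi(i)\neq i$ then $S_{\pi(i)}\neq S_i$. The swapped version is $\pi(S)=S_{\pi(1)}\cdots S_{\pi(n)}$. $P$ swap matches $T$ at location $k$ if there is a swap permutation $\pi$ for $P$ with $\pi(P)=T_{[k,k+p-1]}$. Bit vectors have length $p$ with bits indexed $1,\dots,p$; $\&$ and $\mid$ are bitwise AND and OR. $\mathit{LShift}(x)_c=x_{c-1}$ for $c\ge2$, $\mathit{LShift}(x)_1=0$; $\mathit{RShift}(x)_c=x_{c+1}$ for $c\le p-1$, $\mathit{RShift}(x)_p=0$; $\mathit{LSO}(x)=\mathit{LShift}(x)\mid 1$ (i.e. $\mathit{LShift}(x)$ with bit $1$ set to $1$). GSM algorithm: for each $x\in\Sigma$ let $D^x$ be the vector with $D^x_i=1$ iff $P_i=x$. Set $U^0=M^0=D^0=0^p$ (state vectors $D^j$ with numeric superscript are distinct from the symbol masks $D^x$). For $j=1,\dots,t$: $U'^j=\mathit{LSO}(D^{j-1})$, $M'^j=\mathit{LSO}(M^{j-1}\mid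 U^{j-1})$, $D'^j=\mathit{LSO}(M^{j-1}\mid U^{j-1})$; then $U^j=U'^j\,\&\,\mathit{LShift}(D^{T_j})$, $M^j=M'^j\,\&\,D^{T_j}$, $D^j=D'^j\,\&\,\mathit{RShift}(D^{T_j})$; if $U^j_p=1$ or $M^j_p=1$ the algorithm reports a match on position $j-p+1$. -}

module Defs where

open import Data.Nat using (ℕ; zero; suc; _+_; _∸_; _≤_; _<_)
open import Data.Bool using (Bool; true; false; _∧_; _∨_)
open import Data.Fin using (Fin; toℕ; _≟_)
open import Data.Vec using (Vec; []; _∷_; lookup; map; zipWith; _∷ʳ_; toList)
open import Data.List using (List; foldl; take)
open import Data.Fin.Permutation using (Permutation′; _⟨$⟩ʳ_)
open import Data.Integer using (ℤ; +_; _-_)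
open import Data.Product using (Σ; ∃; _×_; _,_)
open import Data.Sum using (_⊎_)
open import Relation.Binary.PropositionalEquality using (_≡_; _≢_)
open import Relation.Nullary.Decidable using (⌊_⌋)

-- Internally Vec/Fin indices are
-- 0-based: the paper's symbol S_i is  lookup S i'  with toℕ i' = i - 1.

Adjacent : {n : ℕ} → Fin n → Fin n → Set
Adjacent i j = toℕ j ≡ toℕ i ⊎ (suc (toℕ j) ≡ toℕ i ⊎ toℕ j ≡ suc (toℕ i))

record IsSwapPermutation {s p : ℕ} (S : Vec (Fin s) p) (π : Permutation′ p) : Set where
  field
    involutive : ∀ i j → π ⟨$⟩ʳ i ≡ j → π ⟨$⟩ʳ j ≡ i
    adjacent   : ∀ i → Adjacent i (π ⟨$⟩ʳ i)
    distinct   : ∀ i → π ⟨$⟩ʳ i ≢ i → lookup S (π ⟨$⟩ʳ i) ≢ lookup S i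

-- P swap matches T at (1-based) location k:  there is a swap permutation
-- π for P with π(P) = T[k, k+p-1]  (in particular 1 ≤ k and k+p-1 ≤ t).
SwapMatches : {s p t : ℕ} → Vec (Fin s) p → Vec (Fin s) t → ℤ → Set
SwapMatches {s} {p} {t} P T k =
  Σ ℕ λ k′ → k ≡ + k′ × 1 ≤ k′ × k′ + p ∸ 1 ≤ t ×
    Σ (Permutation′ p) λ π → IsSwapPermutation P π ×
      (∀ (i : Fin p) (n : Fin t) → toℕ n ≡ (k′ ∸ 1) + toℕ i →
         lookup P (π ⟨$⟩ʳ i) ≡ lookup T n)

-- Bit vectors (bit c of the paper is entry c-1 of the Vec)

BitVec : ℕ → Set
BitVec p = Vec Bool p

_&_ : {p : ℕ} → BitVec p → BitVec p → BitVec p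
_&_ = zipWith _∧_

_∣_ : {p : ℕ} → BitVec p → BitVec p → BitVec p
_∣_ = zipWith _∨_

shiftIn : {p : ℕ} → Bool → BitVec p → BitVec p
shiftIn b [] = []
shiftIn b (x ∷ xs) = b ∷ shiftIn x xs

-- LShift(x)_c = x_{c-1}, LShift(x)_1 = 0
LShift : {p : ℕ} → BitVec p → BitVec p
LShift = shiftIn false

RShift : {p : ℕ} → BitVec p → BitVec p
RShift [] = []
RShift (_ ∷ xs) = xs ∷ʳ false

-- LSO(x) = LShift(x) | 1
LSO : {p : ℕ} → BitVec p → BitVec p
LSO = shiftIn true

zeros : {p : ℕ} → BitVec p
zeros {zero} = []
zeros {suc p} = false ∷ zeros

-- bit p (the last bit); only used for p ≥ 1
lastBit : {p : ℕ} → BitVec p → Bool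
lastBit [] = false
lastBit (x ∷ []) = x
lastBit (_ ∷ y ∷ ys) = lastBit (y ∷ ys)

mask : {s p : ℕ} → Vec (Fin s) p → Fin s → BitVec p
mask P x = map (λ c → ⌊ c ≟ x ⌋) P

record GSMState (p : ℕ) : Set where
  constructor ⟨_,_,_⟩
  field
    U : BitVec p
    M : BitVec p
    D : BitVec p

initState : {p : ℕ} → GSMState p
initState = ⟨ zeros , zeros , zeros ⟩

gsmStep : {s p : ℕ} → Vec (Fin s) p → GSMState p → Fin s → GSMState p
gsmStep P ⟨ U , M , D ⟩ c =
  ⟨ LSO D & LShift (mask P c)
  , LSO (M ∣ U) & mask P c
  , LSO (M ∣ U) & RShift (mask P c) ⟩

gsmState : {s p t : ℕ} → Vec (Fin s) p → Vec (Fin s) t → ℕ → GSMState p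
gsmState P T j = foldl (gsmStep P) initState (take j (toList T))

ReportsAtIteration : {s p t : ℕ} → Vec (Fin s) p → Vec (Fin s) t → ℕ → Set
ReportsAtIteration P T j =
  lastBit (GSMState.U (gsmState P T j)) ≡ true ⊎ lastBit (GSMState.M (gsmState P T j)) ≡ true

-- the algorithm reports a match on position k (an integer, a priori possibly ≤ 0):
-- some iteration j with 1 ≤ j ≤ t reports, and k = j - p + 1
ReportsMatchOn : {s p t : ℕ} → Vec (Fin s) p → Vec (Fin s) t → ℤ → Set
ReportsMatchOn {s} {p} {t} P T k =
  Σ ℕ λ j → 1 ≤ j × j ≤ t × ReportsAtIteration P T j × k ≡ (+ suc j) - (+ p)

module Submission where

-- Positions are 0-based natural numbers, and strings are read through the
-- total lookup  xs ! i  (which is  nothing  outside the string), so that no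
-- range proofs are needed until the very end.
--
-- The Boolean  swapPrefix i j  ("P[0,i) swap
--    matches T[j-i,j)") obeys a recurrence: the last symbol is matched in
--    place, or the last two symbols are exchanged.  After reading T[0,j) the
--    vectors M and U hold exactly these two cases (and D the first half of an
--    exchange), so bit p of LSO(M | U) is  swapPrefix p j : iteration j
--    reports a match iff  swapPrefix p j.
-- 3. Alignments.  Aligned i k  is an involution of [0,i) moving positions by
--    at most one, only between distinct symbols, that carries P[0,i) onto
--    T[k,k+i).  Alignments are built and taken apart one kept position or one
--    exchanged pair at a time (LastStep), which gives
--    swapPrefix i (i + k) ≡ true  iff  Aligned i k  is inhabited; for i = p
--    alignments are exactly the swap permutations of the paper.
-- The theorem combines 2 and 3 with the index arithmetic k = j - p + 1.

open import Defs
open import Data.Nat using (ℕ; zero; suc; _+_; _∸_; _≤_; _<_; z≤n; s≤s; s≤s⁻¹; _<?_)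
open import Data.Nat.Properties
  using (≤-refl; ≤-trans; ≤-antisym; <-≤-trans; <⇒≤; <⇒≱; <-≤-connex; <-irrefl;
         n<1+n; n≤1+n; m≤m+n; +-comm; +-suc; suc-injective; +-monoˡ-<; m+n∸n≡m; m+n∸m≡n)
open import Data.Bool using (Bool; true; false; _∧_; _∨_)
open import Data.Bool.Properties using (∧-zeroʳ; ∨-zeroʳ; ∧-conicalˡ; ∧-conicalʳ; T-≡)
open import Data.Fin using (Fin; toℕ; fromℕ<; _≟_)
import Data.Fin as Fin
open import Data.Fin.Properties using (toℕ-fromℕ<; toℕ-injective; toℕ<n; fromℕ<-toℕ)
open import Data.Fin.Permutation using (Permutation′; _⟨$⟩ʳ_; permutation)
open import Data.Vec using (Vec; []; _∷_; lookup; _∷ʳ_; toList)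
import Data.List as List
open import Data.Maybe using (Maybe; just; nothing; fromMaybe)
open import Data.Maybe.Properties using (just-injective; ≡-dec)
open import Data.Product using (Σ; ∃; _×_; _,_; proj₁; proj₂)
open import Data.Sum using (_⊎_; inj₁; inj₂; swap)
open import Data.Empty using (⊥-elim)
open import Data.Integer using (ℤ; +_; _-_; _⊖_)
open import Data.Integer.Properties using (m-n≡m⊖n; ⊖-≥)
open import Function using (id; _∘_)
open import Function.Bundles using (_⇔_; mk⇔; Equivalence)
open import Relation.Nullary using (yes; no)
open import Relation.Nullary.Decidable using (⌊_⌋; toWitness; isYes≗does; dec-true)
open import Relation.Binary.PropositionalEquality
  using (_≡_; _≢_; refl; sym; trans; cong; cong₂; subst; module ≡-Reasoning)

open ≡-Reasoning

infixl 30 _!_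
_!_ : {A : Set} {n : ℕ} → Vec A n → ℕ → Maybe A
[] ! _ = nothing
(x ∷ xs) ! zero = just x
(x ∷ xs) ! suc i = xs ! i

!-lookup : {A : Set} {n : ℕ} (xs : Vec A n) (i : Fin n) → xs ! toℕ i ≡ just (lookup xs i)
!-lookup (x ∷ xs) Fin.zero = refl
!-lookup (x ∷ xs) (Fin.suc i) = !-lookup xs i

!-lookup′ : {A : Set} {n : ℕ} (xs : Vec A n) (x : Fin n) {a : ℕ} → toℕ x ≡ a → xs ! a ≡ just (lookup xs x)
!-lookup′ xs x refl = !-lookup xs x

!-inRange : {A : Set} {n : ℕ} (xs : Vec A n) {i : ℕ} → i < n → ∃ λ x → xs ! i ≡ just x
!-inRange (x ∷ xs) {zero} _ = x , refl
!-inRange (x ∷ xs) {suc i} (s≤s i<n) = !-inRange xs i<n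

foldl-take-suc : {A B : Set} {n : ℕ} (f : B → A → B) (z : B) (xs : Vec A n) {j : ℕ} {a : A} →
  xs ! j ≡ just a →
  List.foldl f z (List.take (suc j) (toList xs)) ≡ f (List.foldl f z (List.take j (toList xs))) a
foldl-take-suc f z (x ∷ xs) {zero} refl = refl
foldl-take-suc f z (x ∷ xs) {suc j} e = foldl-take-suc f (f z x) xs e

∨-true : ∀ {x y} → x ∨ y ≡ true ⇔ (x ≡ true ⊎ y ≡ true)
∨-true {x} = mk⇔ (to x) from
  where
  to : ∀ x {y} → x ∨ y ≡ true → x ≡ true ⊎ y ≡ true
  to true _ = inj₁ refl
  to false e = inj₂ e
  from : ∀ {x y} → x ≡ true ⊎ y ≡ true → x ∨ y ≡ true
  from (inj₁ refl) = refl
  from {x} (inj₂ refl) = ∨-zeroʳ x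

infix 7 _≐_
_≐_ : {s : ℕ} → Maybe (Fin s) → Maybe (Fin s) → Bool
just x ≐ just y = ⌊ x ≟ y ⌋
just _ ≐ nothing = false
nothing ≐ _ = false

≐-sound : {s : ℕ} {x y : Maybe (Fin s)} → x ≐ y ≡ true → x ≡ y
≐-sound {x = just x} {just y} e = cong just (toWitness (Equivalence.from T-≡ e))

≐-refl : {s : ℕ} (x : Fin s) → just x ≐ just x ≡ true
≐-refl x = trans (isYes≗does (x ≟ x)) (dec-true (x ≟ x) refl)

bit : {n : ℕ} → BitVec n → ℕ → Bool
bit x c = fromMaybe false (x ! c)

bit-& : {n : ℕ} (x y : BitVec n) (c : ℕ) → bit (x & y) c ≡ bit x c ∧ bit y c
bit-& [] [] c = refl
bit-& (x ∷ xs) (y ∷ ys) zero = refl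
bit-& (x ∷ xs) (y ∷ ys) (suc c) = bit-& xs ys c

bit-∣ : {n : ℕ} (x y : BitVec n) (c : ℕ) → bit (x ∣ y) c ≡ bit x c ∨ bit y c
bit-∣ [] [] c = refl
bit-∣ (x ∷ xs) (y ∷ ys) zero = refl
bit-∣ (x ∷ xs) (y ∷ ys) (suc c) = bit-∣ xs ys c

bit-shiftIn-zero : {n : ℕ} (b : Bool) (x : BitVec n) → 0 < n → bit (shiftIn b x) 0 ≡ b
bit-shiftIn-zero b (x ∷ xs) _ = refl

bit-shiftIn-suc : {n : ℕ} (b : Bool) (x : BitVec n) (c : ℕ) → suc c < n →
  bit (shiftIn b x) (suc c) ≡ bit x c
bit-shiftIn-suc b (x ∷ xs) zero (s≤s 1<n) = bit-shiftIn-zero x xs 1<n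
bit-shiftIn-suc b (x ∷ xs) (suc c) (s≤s c<n) = bit-shiftIn-suc x xs c c<n

bit-∷ʳ-false : {n : ℕ} (x : BitVec n) (c : ℕ) → bit (x ∷ʳ false) c ≡ bit x c
bit-∷ʳ-false [] zero = refl
bit-∷ʳ-false [] (suc c) = refl
bit-∷ʳ-false (x ∷ xs) zero = refl
bit-∷ʳ-false (x ∷ xs) (suc c) = bit-∷ʳ-false xs c

bit-RShift : {n : ℕ} (x : BitVec n) (c : ℕ) → bit (RShift x) c ≡ bit x (suc c)
bit-RShift [] c = refl
bit-RShift (x ∷ xs) c = bit-∷ʳ-false xs c

bit-zeros : {n : ℕ} (c : ℕ) → bit (zeros {n}) c ≡ false
bit-zeros {zero} c = refl
bit-zeros {suc n} zero = refl
bit-zeros {suc n} (suc c) = bit-zeros {n} c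

lastBit-bit : {n : ℕ} (x : BitVec (suc n)) → lastBit x ≡ bit x n
lastBit-bit (x ∷ []) = refl
lastBit-bit (_ ∷ y ∷ ys) = lastBit-bit (y ∷ ys)

bit-mask : {s n : ℕ} (Q : Vec (Fin s) n) (a : Fin s) (c : ℕ) → bit (mask Q a) c ≡ Q ! c ≐ just a
bit-mask [] a c = refl
bit-mask (x ∷ Q) a zero = refl
bit-mask (x ∷ Q) a (suc c) = bit-mask Q a c

-- One GSM step, bit by bit.  Bit c of LSO(M | U) says whether a match of a
-- prefix of length c may be continued; for c = 0 this is always possible.
continues : {p : ℕ} → GSMState p → ℕ → Bool
continues S zero = true
continues S (suc c) = bit (GSMState.M S) c ∨ bit (GSMState.U S) c

module _ {s p : ℕ} (P : Vec (Fin s) p) (S : GSMState p) (a : Fin s) where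
  open GSMState

  bit-LSO-continues : ∀ c → c < p → bit (LSO (M S ∣ U S)) c ≡ continues S c
  bit-LSO-continues zero 0<p = bit-shiftIn-zero true (M S ∣ U S) 0<p
  bit-LSO-continues (suc c) c<p = trans (bit-shiftIn-suc true (M S ∣ U S) c c<p) (bit-∣ (M S) (U S) c)

  step-U-zero : 0 < p → bit (U (gsmStep P S a)) 0 ≡ false
  step-U-zero 0<p = begin
    bit (LSO (D S) & LShift (mask P a)) 0         ≡⟨ bit-& (LSO (D S)) (LShift (mask P a)) 0 ⟩
    bit (LSO (D S)) 0 ∧ bit (LShift (mask P a)) 0 ≡⟨ cong (_ ∧_) (bit-shiftIn-zero false (mask P a) 0<p) ⟩
    bit (LSO (D S)) 0 ∧ false                     ≡⟨ ∧-zeroʳ _ ⟩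
    false                                         ∎

  step-U-suc : ∀ c → suc c < p → bit (U (gsmStep P S a)) (suc c) ≡ bit (D S) c ∧ bit (mask P a) c
  step-U-suc c c<p = trans (bit-& (LSO (D S)) (LShift (mask P a)) (suc c))
    (cong₂ _∧_ (bit-shiftIn-suc true (D S) c c<p) (bit-shiftIn-suc false (mask P a) c c<p))

  step-M : ∀ c → c < p → bit (M (gsmStep P S a)) c ≡ continues S c ∧ bit (mask P a) c
  step-M c c<p = trans (bit-& (LSO (M S ∣ U S)) (mask P a) c) (cong (_∧ _) (bit-LSO-continues c c<p))

  step-D : ∀ c → c < p → bit (D (gsmStep P S a)) c ≡ continues S c ∧ bit (mask P a) (suc c)
  step-D c c<p = trans (bit-& (LSO (M S ∣ U S)) (RShift (mask P a)) c)
    (cong₂ _∧_ (bit-LSO-continues c c<p) (bit-RShift (mask P a) c))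

Near : ℕ → ℕ → Set
Near a b = b ≡ a ⊎ (suc b ≡ a ⊎ b ≡ suc a)

patch : (ℕ → ℕ) → ℕ → (ℕ → ℕ) → ℕ → ℕ
patch f i g a with a <? i
... | yes _ = f a
... | no _ = g a

patch-below : ∀ {f g i a} → a < i → patch f i g a ≡ f a
patch-below {i = i} {a} a<i with a <? i
... | yes _ = refl
... | no a≮i = ⊥-elim (a≮i a<i)

patch-above : ∀ {f g i a} → i ≤ a → patch f i g a ≡ g a
patch-above {i = i} {a} i≤a with a <? i
... | yes a<i = ⊥-elim (<⇒≱ a<i i≤a)
... | no _ = refl

-- The map exchanging i and i + 1 (its other values are irrelevant).
exchange : ℕ → ℕ → ℕ
exchange i a = suc (i + i) ∸ a

exchange-left : ∀ i → exchange i i ≡ suc i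
exchange-left i = m+n∸n≡m (suc i) i

exchange-right : ∀ i → exchange i (suc i) ≡ i
exchange-right i = m+n∸n≡m i i

inBlock₁ : ∀ {i a} → i ≤ a → a < suc i → a ≡ i
inBlock₁ i≤a a<1+i = ≤-antisym (s≤s⁻¹ a<1+i) i≤a

inBlock₂ : ∀ {i a} → i ≤ a → a < suc (suc i) → a ≡ i ⊎ a ≡ suc i
inBlock₂ {i} {a} i≤a a<2+i with <-≤-connex a (suc i)
... | inj₁ a<1+i = inj₁ (inBlock₁ i≤a a<1+i)
... | inj₂ 1+i≤a = inj₂ (inBlock₁ 1+i≤a a<2+i)

liftFin : {p : ℕ} → (Fin p → Fin p) → ℕ → ℕ
liftFin {p} g a with a <? p
... | yes a<p = toℕ (g (fromℕ< a<p))
... | no _ = a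

liftFin-toℕ : {p : ℕ} (g : Fin p → Fin p) (x : Fin p) → liftFin g (toℕ x) ≡ toℕ (g x)
liftFin-toℕ {p} g x with toℕ x <? p
... | yes x<p = cong (toℕ ∘ g) (fromℕ<-toℕ x x<p)
... | no x≮p = ⊥-elim (x≮p (toℕ<n x))

belowFromFin : {p : ℕ} (Q : ℕ → Set) → (∀ (x : Fin p) → Q (toℕ x)) → ∀ a → a < p → Q a
belowFromFin Q H a a<p = subst Q (toℕ-fromℕ< a<p) (H (fromℕ< a<p))

module GSM {s p t : ℕ} (P : Vec (Fin s) p) (T : Vec (Fin s) t) where
  open GSMState

  agree : ℕ → ℕ → Bool
  agree a b = P ! a ≐ T ! b

  -- swapPrefix i j : P[0,i) swap matches T[j-i,j).
  -- endsSwapped i j : P[0,i+1) swap matches T[j-i,j+1) with its last two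
  -- symbols exchanged.
  swapPrefix : ℕ → ℕ → Bool
  endsSwapped : ℕ → ℕ → Bool
  swapPrefix zero j = true
  swapPrefix (suc i) zero = false
  swapPrefix (suc i) (suc j) = (swapPrefix i j ∧ agree i j) ∨ endsSwapped i j
  endsSwapped (suc i) (suc j) = (swapPrefix i j ∧ agree (suc i) j) ∧ agree i (suc j)
  endsSwapped _ _ = false

  -- The intended value of bit c of U, M, D after T[0,j) has been read:
  -- M ends a match with P_c = T_{j-1} in place, D starts an exchange with
  -- P_{c+1} = T_{j-1}, and U ends a match with an exchange.
  expectedU expectedM expectedD : ℕ → ℕ → Bool
  expectedU zero c = false
  expectedU (suc j) c = endsSwapped c j
  expectedM zero c = false
  expectedM (suc j) c = swapPrefix c j ∧ agree c j
  expectedD zero c = false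
  expectedD (suc j) c = swapPrefix c j ∧ agree (suc c) j

  swapPrefix-suc : ∀ c j → swapPrefix (suc c) j ≡ expectedM j c ∨ expectedU j c
  swapPrefix-suc c zero = refl
  swapPrefix-suc c (suc j) = refl

  endsSwapped-suc : ∀ c j → endsSwapped (suc c) j ≡ expectedD j c ∧ agree c j
  endsSwapped-suc c zero = refl
  endsSwapped-suc c (suc j) = refl

  state : ℕ → GSMState p
  state j = gsmState P T j

  state-suc : ∀ {j a} → T ! j ≡ just a → state (suc j) ≡ gsmStep P (state j) a
  state-suc = foldl-take-suc (gsmStep P) initState T

  mask-agree : ∀ {j a} → T ! j ≡ just a → ∀ c → bit (mask P a) c ≡ agree c j
  mask-agree {a = a} e c = trans (bit-mask P a c) (cong (P ! c ≐_) (sym e))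

  record Invariant (j : ℕ) : Set where
    field
      U-bit : ∀ c → c < p → bit (U (state j)) c ≡ expectedU j c
      M-bit : ∀ c → c < p → bit (M (state j)) c ≡ expectedM j c
      D-bit : ∀ c → c < p → bit (D (state j)) c ≡ expectedD j c
  open Invariant

  invariant-zero : Invariant 0
  invariant-zero = record
    { U-bit = λ c _ → bit-zeros {p} c ; M-bit = λ c _ → bit-zeros {p} c ; D-bit = λ c _ → bit-zeros {p} c }

  continues-invariant : ∀ {j} → Invariant j → ∀ c → c ≤ p → continues (state j) c ≡ swapPrefix c j
  continues-invariant I zero _ = refl
  continues-invariant {j} I (suc c) c<p =
    trans (cong₂ _∨_ (M-bit I c c<p) (U-bit I c c<p)) (sym (swapPrefix-suc c j))

  invariant-suc : ∀ {j a} → T ! j ≡ just a → Invariant j → Invariant (suc j)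
  invariant-suc {j} {a} e I = record { U-bit = U-bit′ ; M-bit = M-bit′ ; D-bit = D-bit′ }
    where
    S = state j
    U-bit′ : ∀ c → c < p → bit (U (state (suc j))) c ≡ expectedU (suc j) c
    U-bit′ zero 0<p rewrite state-suc e = step-U-zero P S a 0<p
    U-bit′ (suc c) c<p rewrite state-suc e = begin
      bit (U (gsmStep P S a)) (suc c) ≡⟨ step-U-suc P S a c c<p ⟩
      bit (D S) c ∧ bit (mask P a) c  ≡⟨ cong₂ _∧_ (D-bit I c (<⇒≤ c<p)) (mask-agree e c) ⟩
      expectedD j c ∧ agree c j       ≡⟨ sym (endsSwapped-suc c j) ⟩
      endsSwapped (suc c) j           ∎
    M-bit′ : ∀ c → c < p → bit (M (state (suc j))) c ≡ expectedM (suc j) c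
    M-bit′ c c<p rewrite state-suc e = trans (step-M P S a c c<p)
      (cong₂ _∧_ (continues-invariant I c (<⇒≤ c<p)) (mask-agree e c))
    D-bit′ : ∀ c → c < p → bit (D (state (suc j))) c ≡ expectedD (suc j) c
    D-bit′ c c<p rewrite state-suc e = trans (step-D P S a c c<p)
      (cong₂ _∧_ (continues-invariant I c (<⇒≤ c<p)) (mask-agree e (suc c)))

  invariant : ∀ {j} → j ≤ t → Invariant j
  invariant {zero} _ = invariant-zero
  invariant {suc j} j<t with !-inRange T j<t
  ... | a , e = invariant-suc e (invariant (<⇒≤ j<t))

  record ValidAt (k : ℕ) (f : ℕ → ℕ) (a : ℕ) : Set where
    field
      involutive : f (f a) ≡ a
      near       : Near a (f a)
      distinct   : f a ≢ a → P ! f a ≢ P ! a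
      matches    : agree (f a) (a + k) ≡ true

  mkValid : ∀ {k g a b} → g a ≡ b → g b ≡ a → Near a b → (b ≢ a → P ! b ≢ P ! a) →
    agree b (a + k) ≡ true → ValidAt k g a
  mkValid refl gb≡a nr dis mat =
    record { involutive = gb≡a ; near = nr ; distinct = dis ; matches = mat }

  ValidAt-transfer : ∀ {k f g a} → g a ≡ f a → g (f a) ≡ f (f a) → ValidAt k f a → ValidAt k g a
  ValidAt-transfer ga≡fa gfa≡ffa v = mkValid ga≡fa (trans gfa≡ffa involutive) near distinct matches
    where open ValidAt v

  record Aligned (i k : ℕ) : Set where
    field
      f      : ℕ → ℕ
      closed : ∀ a → a < i → f a < i
      valid  : ∀ a → a < i → ValidAt k f a

  empty : ∀ {k} → Aligned 0 k
  empty = record { f = id ; closed = λ _ () ; valid = λ _ () }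

  ValidOn : ℕ → ℕ → ℕ → (ℕ → ℕ) → Set
  ValidOn k i i′ g = ∀ a → i ≤ a → a < i′ → (i ≤ g a × g a < i′) × ValidAt k g a

  glue : ∀ {i i′ k} → i ≤ i′ → Aligned i k → (g : ℕ → ℕ) → ValidOn k i i′ g → Aligned i′ k
  glue {i} {i′} {k} i≤i′ A g block = record { f = patch f i g ; closed = closed′ ; valid = valid′ }
    where
    open Aligned A
    closed′ : ∀ a → a < i′ → patch f i g a < i′
    closed′ a a<i′ with <-≤-connex a i
    ... | inj₁ a<i = subst (_< i′) (sym (patch-below a<i)) (<-≤-trans (closed a a<i) i≤i′)
    ... | inj₂ i≤a = subst (_< i′) (sym (patch-above i≤a)) (proj₂ (proj₁ (block a i≤a a<i′)))
    valid′ : ∀ a → a < i′ → ValidAt k (patch f i g) a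
    valid′ a a<i′ with <-≤-connex a i
    ... | inj₁ a<i = ValidAt-transfer (patch-below a<i) (patch-below (closed a a<i)) (valid a a<i)
    ... | inj₂ i≤a = ValidAt-transfer (patch-above i≤a) (patch-above (proj₁ (proj₁ (block a i≤a a<i′))))
                                      (proj₂ (block a i≤a a<i′))

  -- An alignment of [0,I) restricts to [0,i) when no position of [i,I) is
  -- mapped below i (by involutivity, nothing below i is then mapped above).
  restrict : ∀ {i I k} → i ≤ I → (A : Aligned I k) → (∀ b → i ≤ b → b < I → i ≤ Aligned.f A b) →
    Aligned i k
  restrict {i} i≤I A upper =
    record { f = f ; closed = closed′ ; valid = λ a a<i → valid a (<-≤-trans a<i i≤I) }
    where
    open Aligned A
    closed′ : ∀ a → a < i → f a < i
    closed′ a a<i with <-≤-connex (f a) i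
    ... | inj₁ fa<i = fa<i
    ... | inj₂ i≤fa = ⊥-elim (<⇒≱ a<i (subst (i ≤_) (ValidAt.involutive (valid a a<I))
                                               (upper (f a) i≤fa (closed a a<I))))
      where a<I = <-≤-trans a<i i≤I

  keepBlock : ∀ {i k} → agree i (i + k) ≡ true → ValidOn k i (suc i) id
  keepBlock e a i≤a a<1+i with inBlock₁ i≤a a<1+i
  ... | refl = (≤-refl , n<1+n a) , mkValid refl refl (inj₁ refl) (λ moved → ⊥-elim (moved refl)) e

  exchangeBlock : ∀ {i k} → P ! i ≢ P ! suc i → agree (suc i) (i + k) ≡ true → agree i (suc i + k) ≡ true →
    ValidOn k i (suc (suc i)) (exchange i)
  exchangeBlock {i} differ e₁ e₂ a i≤a a<2+i with inBlock₂ i≤a a<2+i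
  ... | inj₁ refl = (subst (λ b → i ≤ b × b < suc (suc i)) (sym (exchange-left i)) (n≤1+n i , ≤-refl))
                  , mkValid (exchange-left i) (exchange-right i) (inj₂ (inj₂ refl)) (λ _ → differ ∘ sym) e₁
  ... | inj₂ refl = (subst (λ b → i ≤ b × b < suc (suc i)) (sym (exchange-right i)) (≤-refl , n≤1+n (suc i)))
                  , mkValid (exchange-right i) (exchange-left i) (inj₂ (inj₁ refl)) (λ _ → differ) e₂

  extendKeep : ∀ {i k} → Aligned i k → agree i (i + k) ≡ true → Aligned (suc i) k
  extendKeep A e = glue (n≤1+n _) A id (keepBlock e)

  data LastStep (k : ℕ) : ℕ → Set where
    kept      : ∀ {i} → Aligned i k → agree i (i + k) ≡ true → LastStep k (suc i)
    exchanged : ∀ {i} → Aligned i k → agree (suc i) (i + k) ≡ true → agree i (suc i + k) ≡ true →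
                LastStep k (suc (suc i))

  -- Every last step extends to an alignment; an exchange of equal symbols is
  -- realised by keeping both of them.
  extend : ∀ {i k} → LastStep k i → Aligned i k
  extend (kept A e) = extendKeep A e
  extend {k = k} (exchanged {i} A e₁ e₂) with ≡-dec _≟_ (P ! i) (P ! suc i)
  ... | yes same = extendKeep (extendKeep A (subst (λ x → x ≐ T ! (i + k) ≡ true) (sym same) e₁))
                              (subst (λ x → x ≐ T ! (suc i + k) ≡ true) same e₂)
  ... | no differ = glue (≤-trans (n≤1+n i) (n≤1+n (suc i))) A (exchange i) (exchangeBlock differ e₁ e₂)

  keptEnd : ∀ {i k} (A : Aligned (suc i) k) → Aligned.f A i ≡ i → LastStep k (suc i)
  keptEnd {i} {k} A fixed = kept (restrict (n≤1+n i) A upper)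
    (subst (λ b → agree b (i + k) ≡ true) fixed (ValidAt.matches (valid i (n<1+n i))))
    where
    open Aligned A
    upper : ∀ b → i ≤ b → b < suc i → i ≤ f b
    upper b i≤b b<1+i rewrite inBlock₁ i≤b b<1+i | fixed = ≤-refl

  exchangedEnd : ∀ {i k} (A : Aligned (suc i) k) → suc (Aligned.f A i) ≡ i → LastStep k (suc i)
  exchangedEnd {zero} A ()
  exchangedEnd {suc i} {k} A down = exchanged (restrict (≤-trans (n≤1+n i) (n≤1+n (suc i))) A upper) e₁ e₂
    where
    open Aligned A
    f-last : f (suc i) ≡ i
    f-last = suc-injective down
    f-prev : f i ≡ suc i
    f-prev = trans (cong f (sym f-last)) (ValidAt.involutive (valid (suc i) (n<1+n (suc i))))
    upper : ∀ b → i ≤ b → b < suc (suc i) → i ≤ f b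
    upper b i≤b b<2+i with inBlock₂ i≤b b<2+i
    ... | inj₁ refl = subst (i ≤_) (sym f-prev) (n≤1+n i)
    ... | inj₂ refl = subst (i ≤_) (sym f-last) ≤-refl
    e₁ : agree (suc i) (i + k) ≡ true
    e₁ = subst (λ b → agree b (i + k) ≡ true) f-prev
           (ValidAt.matches (valid i (<-≤-trans (n<1+n i) (n≤1+n (suc i)))))
    e₂ : agree i (suc i + k) ≡ true
    e₂ = subst (λ b → agree b (suc i + k) ≡ true) f-last (ValidAt.matches (valid (suc i) (n<1+n (suc i))))

  -- Conversely, every alignment of a nonempty prefix arises from a last step:
  -- the last position cannot move up, as the alignment stays within the prefix.
  lastStep : ∀ {i k} → Aligned (suc i) k → LastStep k (suc i)
  lastStep {i} A with ValidAt.near (Aligned.valid A i (n<1+n i))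
  ... | inj₁ fixed = keptEnd A fixed
  ... | inj₂ (inj₁ down) = exchangedEnd A down
  ... | inj₂ (inj₂ up) = ⊥-elim (<-irrefl up (Aligned.closed A i (n<1+n i)))

  endsSwapped-parts : ∀ i j → endsSwapped (suc i) (suc j) ≡ true →
    swapPrefix i j ≡ true × agree (suc i) j ≡ true × agree i (suc j) ≡ true
  endsSwapped-parts i j e = ∧-conicalˡ _ _ first , ∧-conicalʳ _ _ first , ∧-conicalʳ (swapPrefix i j ∧ agree (suc i) j) _ e
    where first = ∧-conicalˡ (swapPrefix i j ∧ agree (suc i) j) (agree i (suc j)) e

  swapPrefix-sound : ∀ i j → swapPrefix i j ≡ true → ∃ λ k → j ≡ i + k × Aligned i k
  endsSwapped-sound : ∀ i j → endsSwapped i j ≡ true → ∃ λ k → suc j ≡ suc i + k × Aligned (suc i) k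
  swapPrefix-sound zero j _ = j , refl , empty
  swapPrefix-sound (suc i) zero ()
  swapPrefix-sound (suc i) (suc j) e with Equivalence.to ∨-true e
  ... | inj₂ swapEnd = endsSwapped-sound i j swapEnd
  ... | inj₁ keepEnd with swapPrefix-sound i j (∧-conicalˡ _ _ keepEnd)
  ...   | k , refl , A = k , refl , extend (kept A (∧-conicalʳ _ _ keepEnd))
  endsSwapped-sound zero j ()
  endsSwapped-sound (suc i) zero ()
  endsSwapped-sound (suc i) (suc j) e with endsSwapped-parts i j e
  ... | prefix , e₁ , e₂ with swapPrefix-sound i j prefix
  ...   | k , refl , A = k , refl , extend (exchanged A e₁ e₂)

  swapPrefix-complete : ∀ {i k} → Aligned i k → swapPrefix i (i + k) ≡ true
  swapPrefix-complete {zero} _ = refl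
  swapPrefix-complete {suc i} A with lastStep A
  ... | kept A′ e rewrite swapPrefix-complete A′ | e = refl
  ... | exchanged A′ e₁ e₂ rewrite swapPrefix-complete A′ | e₁ | e₂ = ∨-zeroʳ _

  MatchesAt : ℕ → Permutation′ p → Set
  MatchesAt k π = ∀ (i : Fin p) (n : Fin t) → toℕ n ≡ k + toℕ i → lookup P (π ⟨$⟩ʳ i) ≡ lookup T n

  aligned⇒permutation : ∀ {k} → Aligned p k → Σ (Permutation′ p) λ π → IsSwapPermutation P π × MatchesAt k π
  aligned⇒permutation {k} A = π , isSwap , matching
    where
    open Aligned A
    φ : Fin p → Fin p
    φ x = fromℕ< (closed (toℕ x) (toℕ<n x))
    toℕ-φ : ∀ x → toℕ (φ x) ≡ f (toℕ x)
    toℕ-φ x = toℕ-fromℕ< (closed (toℕ x) (toℕ<n x))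
    validFin : ∀ x → ValidAt k f (toℕ x)
    validFin x = valid (toℕ x) (toℕ<n x)
    φ-involutive : ∀ x → φ (φ x) ≡ x
    φ-involutive x = toℕ-injective (begin
      toℕ (φ (φ x))   ≡⟨ toℕ-φ (φ x) ⟩
      f (toℕ (φ x))   ≡⟨ cong f (toℕ-φ x) ⟩
      f (f (toℕ x))   ≡⟨ ValidAt.involutive (validFin x) ⟩
      toℕ x           ∎)
    π : Permutation′ p
    π = permutation φ φ φ-involutive φ-involutive
    isSwap : IsSwapPermutation P π
    isSwap = record
      { involutive = λ x y φx≡y → trans (cong φ (sym φx≡y)) (φ-involutive x)
      ; adjacent = λ x → subst (Near (toℕ x)) (sym (toℕ-φ x)) (ValidAt.near (validFin x))
      ; distinct = λ x moved same → ValidAt.distinct (validFin x)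
          (λ fx≡x → moved (toℕ-injective (trans (toℕ-φ x) fx≡x)))
          (trans (!-lookup′ P (φ x) (toℕ-φ x)) (trans (cong just same) (sym (!-lookup P x)))) }
    matching : MatchesAt k π
    matching x n n≡k+x = just-injective (begin
      just (lookup P (φ x))   ≡⟨ sym (!-lookup′ P (φ x) (toℕ-φ x)) ⟩
      P ! f (toℕ x)           ≡⟨ ≐-sound (ValidAt.matches (validFin x)) ⟩
      T ! (toℕ x + k)         ≡⟨ !-lookup′ T n (trans n≡k+x (+-comm k (toℕ x))) ⟩
      just (lookup T n)       ∎)

  permutation⇒aligned : ∀ {k} → k + p ≤ t → (π : Permutation′ p) → IsSwapPermutation P π → MatchesAt k π →
    Aligned p k
  permutation⇒aligned {k} k+p≤t π isSwap matching = record
    { f = f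
    ; closed = belowFromFin (λ a → f a < p) (λ x → subst (_< p) (sym (f-toℕ x)) (toℕ<n (π ⟨$⟩ʳ x)))
    ; valid = belowFromFin (ValidAt k f) validFin }
    where
    open IsSwapPermutation isSwap
    f : ℕ → ℕ
    f = liftFin (π ⟨$⟩ʳ_)
    f-toℕ : ∀ x → f (toℕ x) ≡ toℕ (π ⟨$⟩ʳ x)
    f-toℕ = liftFin-toℕ (π ⟨$⟩ʳ_)
    matchesFin : ∀ x → agree (toℕ (π ⟨$⟩ʳ x)) (toℕ x + k) ≡ true
    matchesFin x = begin
      P ! toℕ (π ⟨$⟩ʳ x) ≐ T ! (toℕ x + k)        ≡⟨ cong₂ _≐_ (!-lookup P (π ⟨$⟩ʳ x)) (!-lookup′ T n (toℕ-fromℕ< x+k<t)) ⟩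
      just (lookup P (π ⟨$⟩ʳ x)) ≐ just (lookup T n) ≡⟨ cong (λ y → just y ≐ just (lookup T n)) (matching x n n≡k+x) ⟩
      just (lookup T n) ≐ just (lookup T n)          ≡⟨ ≐-refl (lookup T n) ⟩
      true                                           ∎
      where
      x+k<t : toℕ x + k < t
      x+k<t = <-≤-trans (+-monoˡ-< k (toℕ<n x)) (subst (_≤ t) (+-comm k p) k+p≤t)
      n : Fin t
      n = fromℕ< x+k<t
      n≡k+x : toℕ n ≡ k + toℕ x
      n≡k+x = trans (toℕ-fromℕ< x+k<t) (+-comm (toℕ x) k)
    validFin : ∀ x → ValidAt k f (toℕ x)
    validFin x = mkValid (f-toℕ x) (trans (f-toℕ (π ⟨$⟩ʳ x)) (cong toℕ (involutive x (π ⟨$⟩ʳ x) refl)))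
      (adjacent x)
      (λ moved same → distinct x (moved ∘ cong toℕ)
        (just-injective (trans (sym (!-lookup P (π ⟨$⟩ʳ x))) (trans same (!-lookup P x)))))
      (matchesFin x)

open GSM using (swapPrefix; state; invariant; continues-invariant; swapPrefix-sound; swapPrefix-complete;
                aligned⇒permutation; permutation⇒aligned)

-- Iteration j reports a match exactly when P swap matches T[j-p,j): the
-- reported bits are the two halves of bit p of LSO(M | U).
reports⇔swapPrefix : ∀ {s p t} (P : Vec (Fin s) (suc p)) (T : Vec (Fin s) t) {j} → j ≤ t →
  ReportsAtIteration P T j ⇔ swapPrefix P T (suc p) j ≡ true
reports⇔swapPrefix {p = p} P T {j} j≤t
  rewrite lastBit-bit (GSMState.U (state P T j)) | lastBit-bit (GSMState.M (state P T j))
        | sym (continues-invariant P T (invariant P T j≤t) (suc p) ≤-refl)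
  = mk⇔ (Equivalence.from ∨-true ∘ swap) (swap ∘ Equivalence.to ∨-true)

-- The reported position j - p + 1 for j = p + k is the 1-based location k + 1.
reportedPosition : ∀ p k → + suc (p + k) - + p ≡ + suc k
reportedPosition p k = begin
  + suc (p + k) - + p   ≡⟨ m-n≡m⊖n (suc (p + k)) p ⟩
  suc (p + k) ⊖ p       ≡⟨ cong (_⊖ p) (sym (+-suc p k)) ⟩
  p + suc k ⊖ p         ≡⟨ ⊖-≥ (m≤m+n p (suc k)) ⟩
  + (p + suc k ∸ p)     ≡⟨ cong +_ (m+n∸m≡n p (suc k)) ⟩
  + suc k               ∎

theorem1 : (s p t : ℕ) → 1 ≤ p → (P : Vec (Fin s) p) → (T : Vec (Fin s) t) →
    (k : ℤ) → (ReportsMatchOn P T k → SwapMatches P T k) × (SwapMatches P T k → ReportsMatchOn P T k)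
theorem1 s (suc p) t (s≤s z≤n) P T k = sound , complete
  where
  sound : ReportsMatchOn P T k → SwapMatches P T k
  sound (j , _ , j≤t , reports , k≡)
    with swapPrefix-sound P T (suc p) j (Equivalence.to (reports⇔swapPrefix P T j≤t) reports)
  ... | o , refl , A with aligned⇒permutation P T A
  ...   | π , isSwap , matching =
    suc o , trans k≡ (reportedPosition (suc p) o) , s≤s z≤n , subst (_≤ t) (+-comm (suc p) o) j≤t ,
    π , isSwap , matching

  complete : SwapMatches P T k → ReportsMatchOn P T k
  complete (zero , _ , () , _)
  complete (suc o , k≡ , _ , o+p≤t , π , isSwap , matching) =
    suc p + o , s≤s z≤n , j≤t , Equivalence.from (reports⇔swapPrefix P T j≤t) found ,
    trans k≡ (sym (reportedPosition (suc p) o))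
    where
    j≤t : suc p + o ≤ t
    j≤t = subst (_≤ t) (+-comm o (suc p)) o+p≤t
    found : swapPrefix P T (suc p) (suc p + o) ≡ true
    found = swapPrefix-complete P T (permutation⇒aligned P T o+p≤t π isSwap matching)
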